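{- There are exactly $18$ even bent functions $f:GF(3)^2\to GF(3)$ with $f(0)=0$. The group $GL(2,GF(3))$ acts on the set $\mathbb B$ of these functions by $f\mapsto f\circ\phi$, and $\mathbb B$ splits into exactly two orbits $B_1,B_2$ with $|B_1|=12$ and $|B_2|=6$. The functions in $B_1$ are all regular; the functions in $B_2$ are weakly regular but not regular. For each $f\in\mathbb B$, the level sets $D_1=f^{ -1}(1)$, $D_2=f^{ -1}(2)$ form a weighted partial difference set in the additive group $GF(3)^2$.
   Context: $\zeta=e^{2\pi i/3}$, $W_f(u)=\sum_x\zeta^{f(x)-\langle u,x\rangle}$. $f$ is even if $f(-x)=f(x)$; bent if $|W_f(u)|=p^{n/2}$ for all $u$ (here $p=3,n=2$). A bent $f$ is regular if $W_f(u)/p^{n/2}$ is a $p$-th root of unity for all $u$; weakly regular if there are $\mu\in\mathbb C$ with $|\mu|=1$ and $f^*:GF(p)^n\to GF(p)$ with $W_f(u)=\mu\zeta^{f^*(u)}p^{n/2}$ for all $u$. Pairwise disjoint subsets $D_1,\dots,D_r$ of an additive abelian group $G$ with $0\notin D=\bigcup D_i$ form a weighted partial difference set if there are integers $\lambda_{i,j,\ell},\mu_{i,j}$ such that for all $i,j,\ell$, every nonzero $x\in D_\ell$ equals $d_1-d_2$ with $(d_1,d_2)\in D_i\times D_j$ in exactly $\lambda_{i,j,\ell}$ ways, every nonzero $x\in G\setminus D$ in exactly $\mu_{i,j}$ ways, and each $-D_i$ equals some $D_j$. -}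

module Defs where

open import Data.Nat using (ℕ; zero; suc)
import Data.Nat as ℕ
open import Data.Integer as ℤ using (ℤ; +_; -[1+_])
open import Data.Rational.Unnormalised as ℚ using (ℚᵘ; _≃_)
open import Data.Fin using (Fin; zero; suc; toℕ; _≟_)
open import Data.Bool using (Bool; true; false; _∧_; not; T)
open import Data.Product using (Σ; _×_; _,_; proj₁; proj₂; ∃)
open import Data.List using (List; []; _∷_; map; foldr; length; filterᵇ; cartesianProduct)
open import Data.List.Relation.Unary.Any using (Any)
open import Relation.Nullary using (¬_; Dec; yes; no)
open import Relation.Nullary.Decidable using (⌊_⌋)
open import Relation.Binary.PropositionalEquality using (_≡_; _≗_)

F3 : Set
F3 = Fin 3

mod3 : ℕ → F3
mod3 zero = zero
mod3 (suc zero) = suc zero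
mod3 (suc (suc zero)) = suc (suc zero)
mod3 (suc (suc (suc n))) = mod3 n

_+₃_ : F3 → F3 → F3
a +₃ b = mod3 (toℕ a ℕ.+ toℕ b)

_*₃_ : F3 → F3 → F3
a *₃ b = mod3 (toℕ a ℕ.* toℕ b)

-₃_ : F3 → F3
-₃ a = mod3 (2 ℕ.* toℕ a)

_-₃_ : F3 → F3 → F3
a -₃ b = a +₃ (-₃ b)

V : Set
V = F3 × F3

0V : V
0V = (zero , zero)

_+V_ : V → V → V
(a , b) +V (c , d) = (a +₃ c , b +₃ d)

-V_ : V → V
-V (a , b) = (-₃ a , -₃ b)

_-V_ : V → V → V
x -V y = x +V (-V y)

⟨_,_⟩ : V → V → F3
⟨ (a , b) , (c , d) ⟩ = (a *₃ c) +₃ (b *₃ d)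

_==V_ : V → V → Bool
(a , b) ==V (c , d) = ⌊ a ≟ c ⌋ ∧ ⌊ b ≟ d ⌋

allF3 : List F3
allF3 = zero ∷ suc zero ∷ suc (suc zero) ∷ []

allV : List V
allV = cartesianProduct allF3 allF3

Fun : Set
Fun = V → F3

-- ℤ[ζ] ⊂ ℂ, ζ = e^{2πi/3}: the pair (a , b) stands for a + bζ  (ζ² = -1 - ζ)

Zζ : Set
Zζ = ℤ × ℤ

_+ζ_ : Zζ → Zζ → Zζ
(a , b) +ζ (c , d) = (a ℤ.+ c , b ℤ.+ d)

-- (a + bζ)(c + dζ) = (ac - bd) + (ad + bc - bd)ζ
_*ζ_ : Zζ → Zζ → Zζ
(a , b) *ζ (c , d) = (a ℤ.* c ℤ.- b ℤ.* d , a ℤ.* d ℤ.+ b ℤ.* c ℤ.- b ℤ.* d)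

-- complex conjugation: conj(a + bζ) = a + bζ² = (a - b) - bζ
conjζ : Zζ → Zζ
conjζ (a , b) = (a ℤ.- b , ℤ.- b)

intζ : ℤ → Zζ
intζ n = (n , + 0)

-- ζ^k for k ∈ GF(3) (well defined since ζ³ = 1)
ζ^ : F3 → Zζ
ζ^ zero = (+ 1 , + 0)
ζ^ (suc zero) = (+ 0 , + 1)
ζ^ (suc (suc zero)) = (-[1+ 0 ] , -[1+ 0 ])

sumζ : List Zζ → Zζ
sumζ = foldr _+ζ_ (+ 0 , + 0)

W : Fun → V → Zζ
W f u = sumζ (map (λ x → ζ^ (f x -₃ ⟨ u , x ⟩)) allV)

-- ℚ(ζ) ⊂ ℂ : pairs (a , b) of rationals standing for a + bζ

Qζ : Set
Qζ = ℚᵘ × ℚᵘ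

_*q_ : Qζ → Qζ → Qζ
(a , b) *q (c , d) = (a ℚ.* c ℚ.- b ℚ.* d , a ℚ.* d ℚ.+ b ℚ.* c ℚ.- b ℚ.* d)

conjq : Qζ → Qζ
conjq (a , b) = (a ℚ.- b , ℚ.- b)

_≈q_ : Qζ → Qζ → Set
(a , b) ≈q (c , d) = (a ≃ c) × (b ≃ d)

toQζ : Zζ → Qζ
toQζ (a , b) = (a ℚ./ 1 , b ℚ./ 1)

1q : Qζ
1q = (ℚ.1ℚᵘ , ℚ.0ℚᵘ)

-- Even, bent, regular, weakly regular   (p = 3, n = 2, p^{n/2} = 3)

Even : Fun → Set
Even f = ∀ x → f (-V x) ≡ f x

-- |W_f(u)| = 3, i.e. W_f(u) · conj(W_f(u)) = 9
Bent : Fun → Set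
Bent f = ∀ u → W f u *ζ conjζ (W f u) ≡ intζ (+ 9)

-- W_f(u)/3 is a cube root of unity, i.e. W_f(u) = 3 ζ^k for some k
Regular : Fun → Set
Regular f = ∀ u → ∃ λ (k : F3) → W f u ≡ intζ (+ 3) *ζ ζ^ k

WeaklyRegular : Fun → Set
WeaklyRegular f =
  Σ Qζ λ μ → Σ Fun λ fstar →
    ((μ *q conjq μ) ≈q 1q) ×
    (∀ u → toQζ (W f u) ≈q (μ *q toQζ (ζ^ (fstar u) *ζ intζ (+ 3))))

InB : Fun → Set
InB f = Even f × Bent f × (f 0V ≡ zero)

record Mat : Set where
  constructor mat
  field a b c d : F3

det : Mat → F3
det (mat a b c d) = (a *₃ d) -₃ (b *₃ c)

GL2 : Set
GL2 = Σ Mat λ m → ¬ (det m ≡ zero)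

apply : GL2 → V → V
apply (mat a b c d , _) (x , y) = ((a *₃ x) +₃ (b *₃ y) , (c *₃ x) +₃ (d *₃ y))

act : Fun → GL2 → Fun
act f φ x = f (apply φ x)

_∈F_ : Fun → List Fun → Set
f ∈F L = Any (λ g → f ≗ g) L

IsOrbit : List Fun → Set
IsOrbit L =
  (∀ f g → f ∈F L → g ∈F L → ∃ λ (φ : GL2) → g ≗ act f φ) ×
  (∀ f → f ∈F L → (φ : GL2) → act f φ ∈F L)

Subset : Set
Subset = V → Bool

allPairsV : List (V × V)
allPairsV = cartesianProduct allV allV

reps : Subset → Subset → V → ℕ
reps Di Dj x =
  length (filterᵇ (λ p → Di (proj₁ p) ∧ Dj (proj₂ p) ∧ ((proj₁ p -V proj₂ p) ==V x)) allPairsV)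

IsWPDS : (r : ℕ) → (Fin r → Subset) → Set
IsWPDS r D =
  (∀ i j → ¬ (i ≡ j) → ∀ x → ¬ (T (D i x) × T (D j x))) ×
  (∀ i → ¬ T (D i 0V)) ×
  (Σ (Fin r → Fin r → Fin r → ℕ) λ λ' → Σ (Fin r → Fin r → ℕ) λ μ' →
     (∀ i j ℓ x → ¬ (x ≡ 0V) → T (D ℓ x) → reps (D i) (D j) x ≡ λ' i j ℓ) ×
     (∀ i j x → ¬ (x ≡ 0V) → (∀ k → ¬ T (D k x)) → reps (D i) (D j) x ≡ μ' i j)) ×
  (∀ i → ∃ λ j → ∀ x → D i (-V x) ≡ D j x)

levelSets : Fun → Fin 2 → Subset
levelSets f zero x = ⌊ f x ≟ suc zero ⌋
levelSets f (suc zero) x = ⌊ f x ≟ suc (suc zero) ⌋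

-- Every object in the theorem is finite, so the proof is by certified
-- computation, organised around one structural reduction.  In order:
--
--  * Finite quantifiers over GF(3)², over 2×2 matrices and over finite
--    lists are decidable; a closed decidable proposition that evaluates
--    to `yes` is proved by `from-yes`.
--  * An even function f with f(0) = 0 is determined by its values on the
--    four representatives of (GF(3)² ∖ {0}) / ±1, so 𝔹 is contained in
--    the 81 functions `evenFun a b c d`; deciding bentness of these shows
--    that 𝔹 is exactly the 18 listed functions `orbit₁ ++ orbit₂`.
--  * All the properties in the statement respect pointwise equality of
--    functions, so checks on the listed representatives transfer to every
--    member of 𝔹 and of the orbits (which are only determined up to ≗).
--  * Disjointness of the level sets, 0 ∉ D and -Dᵢ = Dᵢ hold for every
--    even f with f(0) = 0; only the difference counts and the Walsh values
--    (regularity, weak regularity with μ = -1) are computed.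
--  * The theorem then collects these facts for the two orbit lists.
module Submission where

open import Defs
open import Data.Nat using (ℕ)
open import Data.Product using (Σ; _×_)
open import Data.List using (List; length; _++_)
open import Data.List.Relation.Unary.All using (All)
open import Data.List.Relation.Unary.AllPairs using (AllPairs)
open import Relation.Nullary using (¬_)
open import Relation.Binary.PropositionalEquality using (_≡_; _≗_)

open import Level using (Level)
open import Function using (_∘_)
open import Data.Bool using (Bool; not; T; _∧_)
import Data.Nat as ℕ
open import Data.Integer using (+_; -[1+_])
import Data.Integer as ℤ
import Data.Rational.Unnormalised as ℚ
open import Data.Rational.Unnormalised.Properties using (_≃?_)
open import Data.Fin using (Fin; zero; suc; _≟_)
open import Data.Fin.Properties using (all?; any?; suc-injective)
open import Data.Product using (_,_; proj₁; ∃)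
open import Data.Product.Properties using (≡-dec)
open import Data.Maybe using (fromMaybe)
open import Data.List using ([]; _∷_; findᵇ)
open import Data.List.Properties using (map-cong; filter-≐)
import Data.List.Relation.Unary.Any as Any
import Data.List.Relation.Unary.All as All
open import Data.List.Relation.Unary.AllPairs using (allPairs?)
open import Relation.Nullary using (Dec; does; yes; no)
open import Relation.Nullary.Decidable
  using (⌊_⌋; map′; from-yes; toWitness; ¬?; T?; _×-dec_; _→-dec_)
open import Relation.Binary.Definitions using (DecidableEquality; Decidable)
open import Relation.Binary.PropositionalEquality using (refl; sym; trans; cong; cong₂; subst)

private
  variable
    p : Level

∀V? : {P : V → Set p} → (∀ x → Dec (P x)) → Dec (∀ x → P x)
∀V? P? = map′ (λ h (a , b) → h a b) (λ h a b → h (a , b))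
              (all? λ a → all? λ b → P? (a , b))

∃Mat? : {P : Mat → Set p} → (∀ m → Dec (P m)) → Dec (∃ P)
∃Mat? P? = map′ (λ (a , b , c , d , h) → mat a b c d , h)
                (λ { (mat a b c d , h) → a , b , c , d , h })
                (any? λ a → any? λ b → any? λ c → any? λ d → P? (mat a b c d))

∀Mat? : {P : Mat → Set p} → (∀ m → Dec (P m)) → Dec (∀ m → P m)
∀Mat? P? = map′ (λ h (mat a b c d) → h a b c d) (λ h a b c d → h (mat a b c d))
                (all? λ a → all? λ b → all? λ c → all? λ d → P? (mat a b c d))

infix 4 _≟V_ _≟ζ_ _≈q?_ _≗?_ _∈F?_

_≟V_ : DecidableEquality V
_≟V_ = ≡-dec _≟_ _≟_

_≟ζ_ : DecidableEquality Zζ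
_≟ζ_ = ≡-dec ℤ._≟_ ℤ._≟_

_≈q?_ : Decidable _≈q_
(a , b) ≈q? (c , d) = (a ≃? c) ×-dec (b ≃? d)

_≗?_ : (f g : Fun) → Dec (f ≗ g)
f ≗? g = ∀V? λ x → f x ≟ g x

_∈F?_ : (f : Fun) (L : List Fun) → Dec (f ∈F L)
f ∈F? L = Any.any? (f ≗?_) L

∈F-resp : ∀ {f g} (L : List Fun) → f ≗ g → g ∈F L → f ∈F L
∈F-resp L f≗g = Any.map λ g≗h x → trans (f≗g x) (g≗h x)

lookup≗ : ∀ {P : Fun → Set p} {f} {L : List Fun} → All P L → f ∈F L →
          Σ Fun λ g → P g × f ≗ g
lookup≗ all∈ f∈ = Any.lookup f∈ , All.lookupAny all∈ f∈

W-cong : ∀ {f g} → f ≗ g → ∀ u → W f u ≡ W g u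
W-cong f≗g u = cong sumζ (map-cong (λ x → cong (λ t → ζ^ (t -₃ ⟨ u , x ⟩)) (f≗g x)) allV)

Bent-cong : ∀ {f g} → f ≗ g → Bent f → Bent g
Bent-cong f≗g bent u =
  trans (cong (λ w → w *ζ conjζ w) (sym (W-cong f≗g u))) (bent u)

-- Representatives of the four lines of GF(3)², i.e. of (GF(3)² ∖ {0})/±1.
line₀₁ line₁₀ line₁₁ line₁₂ : V
line₀₁ = (zero , suc zero)
line₁₀ = (suc zero , zero)
line₁₁ = (suc zero , suc zero)
line₁₂ = (suc zero , suc (suc zero))

evenFun : F3 → F3 → F3 → F3 → Fun
evenFun a b c d (zero , zero)                     = zero
evenFun a b c d (zero , suc zero)                 = a
evenFun a b c d (zero , suc (suc zero))           = a
evenFun a b c d (suc zero , zero)                 = b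
evenFun a b c d (suc (suc zero) , zero)           = b
evenFun a b c d (suc zero , suc zero)             = c
evenFun a b c d (suc (suc zero) , suc (suc zero)) = c
evenFun a b c d (suc zero , suc (suc zero))       = d
evenFun a b c d (suc (suc zero) , suc zero)       = d

evenFun-normalForm : ∀ f → Even f → f 0V ≡ zero →
                     f ≗ evenFun (f line₀₁) (f line₁₀) (f line₁₁) (f line₁₂)
evenFun-normalForm f even f0 (zero , zero)                     = f0
evenFun-normalForm f even f0 (zero , suc zero)                 = refl
evenFun-normalForm f even f0 (zero , suc (suc zero))           = even line₀₁
evenFun-normalForm f even f0 (suc zero , zero)                 = refl
evenFun-normalForm f even f0 (suc (suc zero) , zero)           = even line₁₀
evenFun-normalForm f even f0 (suc zero , suc zero)             = refl
evenFun-normalForm f even f0 (suc (suc zero) , suc (suc zero)) = even line₁₁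
evenFun-normalForm f even f0 (suc zero , suc (suc zero))       = refl
evenFun-normalForm f even f0 (suc (suc zero) , suc zero)       = even line₁₂

orbit₁ : List Fun
orbit₁ =
  evenFun 0F 0F 1F 2F ∷ evenFun 0F 0F 2F 1F ∷ evenFun 0F 1F 0F 2F ∷
  evenFun 0F 1F 2F 0F ∷ evenFun 0F 2F 0F 1F ∷ evenFun 0F 2F 1F 0F ∷
  evenFun 1F 0F 0F 2F ∷ evenFun 1F 0F 2F 0F ∷ evenFun 1F 2F 0F 0F ∷
  evenFun 2F 0F 0F 1F ∷ evenFun 2F 0F 1F 0F ∷ evenFun 2F 1F 0F 0F ∷ []
  where 0F 1F 2F : F3
        0F = zero ; 1F = suc zero ; 2F = suc (suc zero)

orbit₂ : List Fun
orbit₂ =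
  evenFun 1F 1F 2F 2F ∷ evenFun 1F 2F 1F 2F ∷ evenFun 1F 2F 2F 1F ∷
  evenFun 2F 1F 1F 2F ∷ evenFun 2F 1F 2F 1F ∷ evenFun 2F 2F 1F 1F ∷ []
  where 1F 2F : F3
        1F = suc zero ; 2F = suc (suc zero)

𝔹 : List Fun
𝔹 = orbit₁ ++ orbit₂

Bent? : ∀ f → Dec (Bent f)
Bent? f = ∀V? λ u → (W f u *ζ conjζ (W f u)) ≟ζ intζ (+ 9)

InB? : ∀ f → Dec (InB f)
InB? f = (∀V? λ x → f (-V x) ≟ f x) ×-dec Bent? f ×-dec (f 0V ≟ zero)

bentEvenFun∈𝔹 : ∀ a b c d → Bent (evenFun a b c d) → evenFun a b c d ∈F 𝔹
bentEvenFun∈𝔹 = from-yes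
  (all? λ a → all? λ b → all? λ c → all? λ d →
     Bent? (evenFun a b c d) →-dec (evenFun a b c d ∈F? 𝔹))

𝔹-complete : ∀ f → InB f → f ∈F 𝔹
𝔹-complete f (even , bent , f0) =
  ∈F-resp 𝔹 normal (bentEvenFun∈𝔹 _ _ _ _ (Bent-cong normal bent))
  where normal = evenFun-normalForm f even f0

linMap : Mat → V → V
linMap (mat a b c d) (x , y) = ((a *₃ x) +₃ (b *₃ y) , (c *₃ x) +₃ (d *₃ y))

apply-linMap : (φ : GL2) → apply φ ≗ linMap (proj₁ φ)
apply-linMap (mat a b c d , _) (x , y) = refl

Invertible : Mat → Set
Invertible m = ¬ (det m ≡ zero)

Transitive : List Fun → Set
Transitive L = All (λ f → All (λ g → ∃ λ m → Invertible m × g ≗ f ∘ linMap m) L) L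

Closed : List Fun → Set
Closed L = All (λ f → ∀ m → Invertible m → (f ∘ linMap m) ∈F L) L

Transitive? : ∀ L → Dec (Transitive L)
Transitive? L = All.all? (λ f → All.all? (λ g →
  ∃Mat? λ m → ¬? (det m ≟ zero) ×-dec (g ≗? f ∘ linMap m)) L) L

Closed? : ∀ L → Dec (Closed L)
Closed? L = All.all? (λ f → ∀Mat? λ m → ¬? (det m ≟ zero) →-dec ((f ∘ linMap m) ∈F? L)) L

isOrbit : ∀ L → Transitive L → Closed L → IsOrbit L
isOrbit L transitive closed = related , stable
  where
  related : ∀ f g → f ∈F L → g ∈F L → ∃ λ (φ : GL2) → g ≗ act f φ
  related f g f∈ g∈ with lookup≗ transitive f∈
  ... | f′ , row , f≗f′ with lookup≗ row g∈
  ... | g′ , (m , inv , g′≗) , g≗g′ = (m , inv) , λ x →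
    trans (g≗g′ x) (trans (g′≗ x)
      (trans (sym (f≗f′ (linMap m x))) (cong f (sym (apply-linMap (m , inv) x)))))

  stable : ∀ f → f ∈F L → (φ : GL2) → act f φ ∈F L
  stable f f∈ (m , inv) with lookup≗ closed f∈
  ... | f′ , close , f≗f′ = ∈F-resp L
    (λ x → trans (cong f (apply-linMap (m , inv) x)) (f≗f′ (linMap m x)))
    (close m inv)

Regular? : ∀ f → Dec (Regular f)
Regular? f = ∀V? λ u → any? λ k → W f u ≟ζ intζ (+ 3) *ζ ζ^ k

orbit₁-regular : All Regular orbit₁
orbit₁-regular = from-yes (All.all? Regular? orbit₁)

-- The exponent k with w = c ζᵏ (0 if there is none).
exponent : Zζ → Zζ → F3
exponent c w with any? (λ k → w ≟ζ c *ζ ζ^ k)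
... | yes (k , _) = k
... | no _        = zero

μ₋₁ : Qζ
μ₋₁ = (ℚ.- ℚ.1ℚᵘ , ℚ.0ℚᵘ)

-- The dual f* of f, read off from the Walsh values W_f(u) = -3 ζ^{f*(u)}.
dual : Fun → Fun
dual f u = exponent (intζ -[1+ 2 ]) (W f u)

WeaklyRegularWith : Qζ → Fun → Fun → Set
WeaklyRegularWith μ f* f =
  ((μ *q conjq μ) ≈q 1q) × (∀ u → toQζ (W f u) ≈q (μ *q toQζ (ζ^ (f* u) *ζ intζ (+ 3))))

WeaklyRegularWith? : ∀ μ f* f → Dec (WeaklyRegularWith μ f* f)
WeaklyRegularWith? μ f* f =
  ((μ *q conjq μ) ≈q? 1q) ×-dec (∀V? λ u → toQζ (W f u) ≈q? (μ *q toQζ (ζ^ (f* u) *ζ intζ (+ 3))))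

orbit₂-weaklyRegular : All (λ f → WeaklyRegular f × ¬ Regular f) orbit₂
orbit₂-weaklyRegular = All.zipWith (λ {f} (wr , nr) → (μ₋₁ , dual f , wr) , nr)
  ( from-yes (All.all? (λ f → WeaklyRegularWith? μ₋₁ (dual f) f) orbit₂)
  , from-yes (All.all? (¬? ∘ Regular?) orbit₂))

Counts : (r : ℕ) → (Fin r → Subset) → (Fin r → Fin r → Fin r → ℕ) → (Fin r → Fin r → ℕ) → Set
Counts r D λ′ μ′ =
  (∀ i j ℓ x → ¬ (x ≡ 0V) → T (D ℓ x) → reps (D i) (D j) x ≡ λ′ i j ℓ) ×
  (∀ i j x → ¬ (x ≡ 0V) → (∀ k → ¬ T (D k x)) → reps (D i) (D j) x ≡ μ′ i j)

Counts? : ∀ r D λ′ μ′ → Dec (Counts r D λ′ μ′)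
Counts? r D λ′ μ′ =
  (all? λ i → all? λ j → all? λ ℓ → ∀V? λ x →
     ¬? (x ≟V 0V) →-dec T? (D ℓ x) →-dec reps (D i) (D j) x ℕ.≟ λ′ i j ℓ) ×-dec
  (all? λ i → all? λ j → ∀V? λ x →
     ¬? (x ≟V 0V) →-dec (all? λ k → ¬? (T? (D k x))) →-dec reps (D i) (D j) x ℕ.≟ μ′ i j)

-- Candidate constants: the counts at the first element of D_ℓ, resp. at the
-- first nonzero element outside D (0V if there is none).
firstIn : (V → Bool) → V
firstIn S = fromMaybe 0V (findᵇ S allV)

λ* : ∀ {r} → (Fin r → Subset) → Fin r → Fin r → Fin r → ℕ
λ* D i j ℓ = reps (D i) (D j) (firstIn (D ℓ))

μ* : ∀ {r} → (Fin r → Subset) → Fin r → Fin r → ℕ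
μ* D i j = reps (D i) (D j)
  (firstIn λ x → not (x ==V 0V) ∧ does (all? λ k → ¬? (T? (D k x))))

reps-cong : ∀ {D D′ E E′ : Subset} → D ≗ D′ → E ≗ E′ → ∀ x → reps D E x ≡ reps D′ E′ x
reps-cong {D} {D′} {E} {E′} D≗D′ E≗E′ x =
  cong length (filter-≐ (T? ∘ test D E) (T? ∘ test D′ E′)
                        ((λ {pr} → subst T (same pr)) , (λ {pr} → subst T (sym (same pr))))
                        allPairsV)
  where
  test : Subset → Subset → V × V → Bool
  test A B (d₁ , d₂) = A d₁ ∧ B d₂ ∧ ((d₁ -V d₂) ==V x)

  same : ∀ pr → test D E pr ≡ test D′ E′ pr
  same (d₁ , d₂) = cong₂ (λ a b → a ∧ b ∧ ((d₁ -V d₂) ==V x)) (D≗D′ d₁) (E≗E′ d₂)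

Counts-cong : ∀ {r} {D D′ : Fin r → Subset} {λ′ μ′} →
              (∀ i → D i ≗ D′ i) → Counts r D λ′ μ′ → Counts r D′ λ′ μ′
Counts-cong {D = D} {D′} D≗D′ (inside , outside) =
  (λ i j ℓ x x≢0 x∈ → trans (reps-cong (sym ∘ D≗D′ i) (sym ∘ D≗D′ j) x)
                             (inside i j ℓ x x≢0 (toD ℓ x x∈))) ,
  (λ i j x x≢0 x∉ → trans (reps-cong (sym ∘ D≗D′ i) (sym ∘ D≗D′ j) x)
                           (outside i j x x≢0 λ k → x∉ k ∘ fromD k x))
  where
  toD : ∀ k x → T (D′ k x) → T (D k x)
  toD k x = subst T (sym (D≗D′ k x))
  fromD : ∀ k x → T (D k x) → T (D′ k x)
  fromD k x = subst T (D≗D′ k x)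

levelSets-cong : ∀ {f g} → f ≗ g → ∀ i → levelSets f i ≗ levelSets g i
levelSets-cong f≗g zero       x = cong (λ t → ⌊ t ≟ suc zero ⌋) (f≗g x)
levelSets-cong f≗g (suc zero) x = cong (λ t → ⌊ t ≟ suc (suc zero) ⌋) (f≗g x)

levelSets-value : ∀ f i x → T (levelSets f i x) → f x ≡ suc i
levelSets-value f zero       x = toWitness
levelSets-value f (suc zero) x = toWitness

levelSets-disjoint : ∀ f i j → ¬ (i ≡ j) → ∀ x → ¬ (T (levelSets f i x) × T (levelSets f j x))
levelSets-disjoint f i j i≢j x (x∈i , x∈j) =
  i≢j (suc-injective
        (trans (sym (levelSets-value f i x x∈i)) (levelSets-value f j x x∈j)))

levelSets-avoid-0 : ∀ f → f 0V ≡ zero → ∀ i → ¬ T (levelSets f i 0V)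
levelSets-avoid-0 f f0 i 0∈ with trans (sym f0) (levelSets-value f i 0V 0∈)
... | ()

levelSets-symmetric : ∀ f → Even f → ∀ i x → levelSets f i (-V x) ≡ levelSets f i x
levelSets-symmetric f even zero       x = cong (λ t → ⌊ t ≟ suc zero ⌋) (even x)
levelSets-symmetric f even (suc zero) x = cong (λ t → ⌊ t ≟ suc (suc zero) ⌋) (even x)

levelSets-wpds-from-counts : ∀ f g {λ′ μ′} → Even f → f 0V ≡ zero → f ≗ g →
  Counts 2 (levelSets g) λ′ μ′ → IsWPDS 2 (levelSets f)
levelSets-wpds-from-counts f g {λ′} {μ′} even f0 f≗g counts =
  levelSets-disjoint f , levelSets-avoid-0 f f0 ,
  (λ′ , μ′ , Counts-cong {D = levelSets g} {levelSets f} {λ′} {μ′}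
                         (λ i → sym ∘ levelSets-cong f≗g i) counts) ,
  λ i → i , levelSets-symmetric f even i

𝔹-counts : All (λ g → Counts 2 (levelSets g) (λ* (levelSets g)) (μ* (levelSets g))) 𝔹
𝔹-counts = from-yes (All.all? (λ g → Counts? 2 (levelSets g) (λ* (levelSets g)) (μ* (levelSets g))) 𝔹)

levelSets-wpds : ∀ f → InB f → IsWPDS 2 (levelSets f)
levelSets-wpds f inB@(even , _ , f0) =
  let g , counts , f≗g = lookup≗ 𝔹-counts (𝔹-complete f inB)
  in levelSets-wpds-from-counts f g even f0 f≗g counts

mainTheorem12 :
    Σ (List Fun) λ B₁ → Σ (List Fun) λ B₂ →
      (length (B₁ ++ B₂) ≡ 18) ×
      AllPairs (λ f g → ¬ (f ≗ g)) (B₁ ++ B₂) ×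
      (∀ f → InB f → f ∈F (B₁ ++ B₂)) ×
      All InB (B₁ ++ B₂) ×
      IsOrbit B₁ × IsOrbit B₂ ×
      (length B₁ ≡ 12) × (length B₂ ≡ 6) ×
      All Regular B₁ ×
      All (λ f → WeaklyRegular f × ¬ Regular f) B₂ ×
      (∀ f → InB f → IsWPDS 2 (levelSets f))
mainTheorem12 =
  orbit₁ , orbit₂ , refl ,
  from-yes (allPairs? (λ f g → ¬? (f ≗? g)) 𝔹) ,
  𝔹-complete ,
  from-yes (All.all? InB? 𝔹) ,
  isOrbit orbit₁ (from-yes (Transitive? orbit₁)) (from-yes (Closed? orbit₁)) ,
  isOrbit orbit₂ (from-yes (Transitive? orbit₂)) (from-yes (Closed? orbit₂)) ,
  refl , refl ,
  orbit₁-regular ,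
  orbit₂-weaklyRegular ,
  levelSets-wpds
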